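{- Let $\mathsf{G}$ and $\mathsf{G}'$ be well-formed global types. If there is a network $\mathsf{N}$ such that $\vdash \mathsf{N} : \mathsf{G}$ and $\vdash \mathsf{N} : \mathsf{G}'$, then the prime event structures $\mathcal{S}(\mathsf{G})$ and $\mathcal{S}(\mathsf{G}')$ are isomorphic.
   Context: Participants are ranged over by $\mathsf{p},\mathsf{q},\mathsf{r},\mathsf{s}$, messages (labels) by $\lambda$. Processes are the possibly infinite but regular (finitely many distinct subterms) terms generated coinductively by $P ::= \mathsf{p}!\{\lambda_i.P_i\}_{i\in I} \mid \mathsf{p}?\{\lambda_i.P_i\}_{i\in I} \mid \mathbf{0}$ (output choice towards $\mathsf{p}$, input choice from $\mathsf{p}$, inaction), with $I$ finite non-empty and $\lambda_h\neq\lambda_k$ for $h\neq k$. A network is $\mathsf{N}=\mathsf{p}_1[P_1]\parallel\cdots\parallel \mathsf{p}_n[P_n]$ with $n\ge1$ and pairwise distinct $\mathsf{p}_h$. Global types are the regular terms generated coinductively by $\mathsf{G} ::= \mathsf{p}\to\mathsf{q}:\{\lambda_i;\mathsf{G}_i\}_{i\in I} \mid \mathsf{End}$, with $I$ finite non-empty and $\lambda_h\neq\lambda_k$ for $h\ne k$. A communication is $\alpha=\mathsf{p}\mathsf{q}\lambda$, with $\mathrm{part}(\alpha)=\{\mathsf{p},\mathsf{q}\}$; a trace is a finite sequence of communications, $\mathrm{part}$ extended to traces by union. The set $\mathrm{Tr}(\mathsf{G})$ of traces of $\mathsf{G}$: $\mathrm{Tr}(\mathsf{End})=\emptyset$, and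 $\mathrm{Tr}(\mathsf{p}\to\mathsf{q}:\{\lambda_i;\mathsf{G}_i\}_{i\in I})$ consists of $\mathsf{p}\mathsf{q}\lambda_j$ and $\mathsf{p}\mathsf{q}\lambda_j\cdot\sigma$ for $j\in I$, $\sigma\in\mathrm{Tr}(\mathsf{G}_j)$ (i.e. sequences of node/edge decorations along paths from the root to an edge of the tree of $\mathsf{G}$). $\mathrm{part}(\mathsf{G})=\bigcup_{\sigma\in\mathrm{Tr}(\mathsf{G})}\mathrm{part}(\sigma)$. For $\sigma\in \mathrm{Tr}(\mathsf{G})$, $\mathsf{G}_\sigma$ denotes the subterm of $\mathsf{G}$ reached after $\sigma$; subtrees of $\mathsf{G}$ are the $\mathsf{G}_\sigma$ (and $\mathsf{G}$ itself). Projection $\mathsf{G}\upharpoonright\mathsf{r}$ (partial, defined coinductively): $\mathsf{G}\upharpoonright\mathsf{r}=\mathbf{0}$ if $\mathsf{r}\notin\mathrm{part}(\mathsf{G})$; otherwise for $\mathsf{G}=\mathsf{p}\to\mathsf{q}:\{\lambda_i;\mathsf{G}_i\}_{i\in I}$: it is $\mathsf{p}?\{\lambda_i.\mathsf{G}_i\upharpoonright\mathsf{r}\}_{i\in I}$ if $\mathsf{r}=\mathsf{q}$; $\mathsf{q}!\{\lambda_i.\mathsf{G}_i\upharpoonright\mathsf{r}\}_{i\in I}$ if $\mathsf{r}=\mathsf{p}$; and $\mathsf{G}_1\upharpoonright\mathsf{r}$ if $\mathsf{r}\notin\{\mathsf{p},\mathsf{q}\}$, $\mathsf{r}\in\mathrm{part}(\mathsf{G}_1)$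 and $\mathsf{G}_i\upharpoonright\mathsf{r}=\mathsf{G}_1\upharpoonright\mathsf{r}$ for all $i\in I$ (undefined otherwise). $\mathsf{G}$ is projectable if $\mathsf{G}\upharpoonright\mathsf{p}$ is defined for all $\mathsf{p}$. Depth: for a trace $\sigma$, $\mathrm{depth}(\mathsf{p},\sigma)=|\sigma_1\cdot\alpha|$ if $\sigma=\sigma_1\cdot\alpha\cdot\sigma_2$ with $\mathsf{p}\notin\mathrm{part}(\sigma_1)$ and $\mathsf{p}\in\mathrm{part}(\alpha)$, and $0$ otherwise; $\mathrm{depth}(\mathsf{p},\mathsf{G})=\sup\{\mathrm{depth}(\mathsf{p},\sigma)\mid\sigma\in\mathrm{Tr}(\mathsf{G})\}$. $\mathsf{G}$ is bounded if $\mathrm{depth}(\mathsf{p},\mathsf{G}')$ is finite for every participant $\mathsf{p}$ and every subtree $\mathsf{G}'$ of $\mathsf{G}$. $\mathsf{G}$ is well formed if it is projectable and bounded. Process preorder $\le$ (rules interpreted coinductively): $\mathbf{0}\le\mathbf{0}$; $\mathsf{p}?\{\lambda_i.P_i\}_{i\in I\cup J}\le \mathsf{p}?\{\lambda_i.Q_i\}_{i\in I}$ if $P_i\le Q_i$ for all $i\in I$; $\mathsf{p}!\{\lambda_i.P_i\}_{i\in I}\le \mathsf{p}!\{\lambda_i.Q_i\}_{i\in I}$ if $P_i\le Q_i$ for all $i\in I$. Typing: $\vdash \prod_{i\in I}\mathsf{p}_i[P_i]:\mathsf{G}$ iff $P_i\le \mathsf{G}\upharpoonright\mathsf{p}_i$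 for all $i\in I$ and $\mathrm{part}(\mathsf{G})\subseteq\{\mathsf{p}_i\mid i\in I\}$. A prime event structure (PES) is $(E,\le,\#)$ with $E$ a denumerable set, $\le$ a partial order, $\#$ irreflexive symmetric with $e\#e'\le e''\Rightarrow e\#e''$. An isomorphism of PESs is a bijection on events preserving and reflecting $\le$ and $\#$. Event structure of a global type: permutation equivalence $\sim$ on traces is the least equivalence with $\sigma\cdot\alpha\cdot\alpha'\cdot\sigma'\sim\sigma\cdot\alpha'\cdot\alpha\cdot\sigma'$ whenever $\mathrm{part}(\alpha)\cap\mathrm{part}(\alpha')=\emptyset$; $[\sigma]$ is the class of $\sigma$. A non-empty trace $\sigma=\sigma[1]\cdots\sigma[n]$ is pointed if for every $1\le i<n$ there is $j$ with $i<j\le n$ and $\mathrm{part}(\sigma[i])\cap\mathrm{part}(\sigma[j])\neq\emptyset$. A g-event is $[\sigma]$ with $\sigma$ pointed. Causal prefixing: $\alpha\circ[\sigma]=[\alpha\cdot\sigma]$ if $\mathrm{part}(\alpha)\cap\mathrm{part}(\sigma)\ne\emptyset$, and $=[\sigma]$ otherwise; $\epsilon\circ\gamma=\gamma$, $(\alpha\cdot\sigma)\circ\gamma=\alpha\circ(\sigma\circ\gamma)$. For a nonempty trace, $\mathrm{ev}(\sigma\cdot\alpha)=\sigma\circ[\alpha]$. On g-events: $\gamma\le\gamma'$ iff $\gamma=[\sigma]$, $\gamma'=[\sigma\cdot\sigma']$ for some $\sigma,\sigma'$; $\gamma\#\gamma'$ iff $\gamma=[\sigma\cdot\mathsf{p}\mathsf{q}\lambda_1\cdot\sigma_1]$,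 $\gamma'=[\sigma\cdot\mathsf{p}\mathsf{q}\lambda_2\cdot\sigma_2]$ with $\lambda_1\ne\lambda_2$. $\mathcal{S}(\mathsf{G})=(\mathcal{E}(\mathsf{G}),\le_{\mathsf{G}},\#_{\mathsf{G}})$ where $\mathcal{E}(\mathsf{G})=\{\mathrm{ev}(\sigma)\mid\sigma\in\mathrm{Tr}(\mathsf{G})\}$ and $\le_{\mathsf{G}},\#_{\mathsf{G}}$ are the restrictions of $\le,\#$. -}

module Defs where

open import Data.Nat using (ℕ; zero; suc; _≡ᵇ_) renaming (_≤_ to _≤ℕ_)
open import Data.Bool using (Bool; true; false; _∨_; if_then_else_)
open import Data.Fin using (Fin)
open import Data.List using (List; []; _∷_; _++_; _∷ʳ_; map; concatMap; foldr)
open import Data.Bool.ListAction using (any)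
open import Data.List.Membership.Propositional using (_∈_; _∉_)
open import Data.List.Relation.Unary.All using (All)
open import Data.List.Relation.Unary.Unique.Propositional using (Unique)
open import Data.Product using (Σ; ∃; ∃-syntax; _×_; _,_; proj₁; proj₂)
open import Data.Unit using (⊤)
open import Data.Sum using (_⊎_)
open import Relation.Binary.PropositionalEquality using (_≡_; _≢_)
open import Relation.Nullary using (¬_)

Participant : Set
Participant = ℕ

Label : Set
Label = ℕ

record Comm : Set where
  constructor comm
  field
    snd : Participant
    rcv : Participant
    lab : Label

open Comm public

Trace : Set
Trace = List Comm

partC : Comm → List Participant
partC α = snd α ∷ rcv α ∷ []

partT : Trace → List Participant
partT = concatMap partC

-- Regular (possibly infinite) trees are presented as finite graphs:
-- a finite set of states  Fin size , a root and a node labelling.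
-- The tree denoted is the unfolding from the root; every regular term
-- arises this way, and every such unfolding is regular.

data GNode (n : ℕ) : Set where
  end : GNode n
  com : (p q : Participant) (bs : List (Label × Fin n)) → GNode n

record GType : Set where
  field
    gsize : ℕ
    groot : Fin gsize
    gnode : Fin gsize → GNode gsize

open GType public

data Path (G : GType) : Fin (gsize G) → Trace → Fin (gsize G) → Set where
  nil  : ∀ {s} → Path G s [] s
  cons : ∀ {s p q bs l s' σ t} → gnode G s ≡ com p q bs → (l , s') ∈ bs →
         Path G s' σ t → Path G s (comm p q l ∷ σ) t

TrAt : (G : GType) → Fin (gsize G) → Trace → Set
TrAt G s σ = σ ≢ [] × ∃[ t ] Path G s σ t

Tr : GType → Trace → Set
Tr G = TrAt G (groot G)

PartAt : (G : GType) → Fin (gsize G) → Participant → Set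
PartAt G s r = ∃[ σ ] (TrAt G s σ × r ∈ partT σ)

-- syntactic side conditions of the grammar (I non-empty, distinct labels,
-- sender different from receiver), imposed on every subtree
OKG : ∀ {n} → GNode n → Set
OKG end = ⊤
OKG (com p q bs) = p ≢ q × bs ≢ [] × Unique (map proj₁ bs)

IsGlobalType : GType → Set
IsGlobalType G = ∀ σ t → Path G (groot G) σ t → OKG (gnode G t)

data PNode (n : ℕ) : Set where
  inact : PNode n
  inp   : (p : Participant) (bs : List (Label × Fin n)) → PNode n
  out   : (p : Participant) (bs : List (Label × Fin n)) → PNode n

record PType : Set where
  field
    psize : ℕ
    proot : Fin psize
    pnode : Fin psize → PNode psize

open PType public

-- states reachable from the root (the subterms of the process)
data PReach (P : PType) : Fin (psize P) → Set where
  here  : PReach P (proot P)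
  there : ∀ {s p bs l t} → PReach P s →
          (pnode P s ≡ inp p bs ⊎ pnode P s ≡ out p bs) → (l , t) ∈ bs → PReach P t

OKP : ∀ {n} → PNode n → Set
OKP inact = ⊤
OKP (inp p bs) = bs ≢ [] × Unique (map proj₁ bs)
OKP (out p bs) = bs ≢ [] × Unique (map proj₁ bs)

IsProcess : PType → Set
IsProcess P = ∀ t → PReach P t → OKP (pnode P t)

-- Projection G ↾ r, as a coinductive relation "G ↾ r is defined and its
-- unfolding is (the unfolding of) Q", encoded as a greatest fixed point:
-- there is a relation R between states of G and states of Q, containing
-- the pair of roots, closed under the projection rules.

BrRel : ∀ {m n} → (Fin m → Fin n → Set) →
        List (Label × Fin m) → List (Label × Fin n) → Set
BrRel R gs qs =
  (∀ {l s'} → (l , s') ∈ gs → ∃[ t' ] ((l , t') ∈ qs × R s' t')) ×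
  (∀ {l t'} → (l , t') ∈ qs → ∃[ s' ] ((l , s') ∈ gs))

data ProjStep (G : GType) (r : Participant) (Q : PType)
              (R : Fin (gsize G) → Fin (psize Q) → Set)
              (s : Fin (gsize G)) (t : Fin (psize Q)) : Set where
  pj-0    : ¬ PartAt G s r → pnode Q t ≡ inact → ProjStep G r Q R s t
  pj-in   : ∀ {p q gs qs} → gnode G s ≡ com p q gs → PartAt G s r → r ≡ q →
            pnode Q t ≡ inp p qs → BrRel R gs qs → ProjStep G r Q R s t
  pj-out  : ∀ {p q gs qs} → gnode G s ≡ com p q gs → PartAt G s r → r ≡ p →
            r ≢ q → pnode Q t ≡ out q qs → BrRel R gs qs → ProjStep G r Q R s t
  pj-skip : ∀ {p q gs} → gnode G s ≡ com p q gs → PartAt G s r → r ≢ p → r ≢ q →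
            (∃[ l ] ∃[ s₁ ] ((l , s₁) ∈ gs × PartAt G s₁ r)) →
            (∀ {l s'} → (l , s') ∈ gs → R s' t) → ProjStep G r Q R s t

Proj : GType → Participant → PType → Set₁
Proj G r Q = ∃[ R ] (R (groot G) (proot Q) ×
                     (∀ s t → R s t → ProjStep G r Q R s t))

Projectable : GType → Set₁
Projectable G = ∀ r → ∃[ Q ] Proj G r Q

depth : Participant → Trace → ℕ
depth p [] = 0
depth p (α ∷ σ) with (p ≡ᵇ snd α) ∨ (p ≡ᵇ rcv α)
... | true  = 1
... | false with depth p σ
...   | zero  = 0
...   | suc k = suc (suc k)

Bounded : GType → Set
Bounded G = ∀ σ s → Path G (groot G) σ s → ∀ p →
            ∃[ n ] (∀ τ → TrAt G s τ → depth p τ ≤ℕ n)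

WellFormed : GType → Set₁
WellFormed G = Projectable G × Bounded G

data LeStep (P Q : PType) (R : Fin (psize P) → Fin (psize Q) → Set)
            (s : Fin (psize P)) (t : Fin (psize Q)) : Set where
  le-0   : pnode P s ≡ inact → pnode Q t ≡ inact → LeStep P Q R s t
  le-in  : ∀ {p ps qs} → pnode P s ≡ inp p ps → pnode Q t ≡ inp p qs →
           (∀ {l t'} → (l , t') ∈ qs → ∃[ s' ] ((l , s') ∈ ps × R s' t')) →
           LeStep P Q R s t
  le-out : ∀ {p ps qs} → pnode P s ≡ out p ps → pnode Q t ≡ out p qs →
           (∀ {l t'} → (l , t') ∈ qs → ∃[ s' ] ((l , s') ∈ ps × R s' t')) →
           (∀ {l s'} → (l , s') ∈ ps → ∃[ t' ] ((l , t') ∈ qs)) →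
           LeStep P Q R s t

_≤P_ : PType → PType → Set₁
P ≤P Q = ∃[ R ] (R (proot P) (proot Q) × (∀ s t → R s t → LeStep P Q R s t))

Network : Set
Network = List (Participant × PType)

names : Network → List Participant
names = map proj₁

IsNetwork : Network → Set
IsNetwork N = N ≢ [] × Unique (names N) × All (λ pP → IsProcess (proj₂ pP)) N

_⊢_ : Network → GType → Set₁
N ⊢ G = (∀ {p P} → (p , P) ∈ N → ∃[ Q ] (Proj G p Q × P ≤P Q)) ×
        (∀ r → PartAt G (groot G) r → r ∈ names N)

-- Event structure of a global type (g-events as classes of traces; we
-- work with representatives and the permutation equivalence as a setoid)

Disjoint : Comm → Comm → Set
Disjoint α β = ∀ x → x ∈ partC α → x ∉ partC β

data _∼_ : Trace → Trace → Set where
  ∼-refl  : ∀ {σ} → σ ∼ σ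
  ∼-sym   : ∀ {σ τ} → σ ∼ τ → τ ∼ σ
  ∼-trans : ∀ {σ τ ρ} → σ ∼ τ → τ ∼ ρ → σ ∼ ρ
  ∼-swap  : ∀ σ α β σ' → Disjoint α β →
            (σ ++ α ∷ β ∷ σ') ∼ (σ ++ β ∷ α ∷ σ')

shares : Comm → Comm → Bool
shares α β = (snd α ≡ᵇ snd β) ∨ (snd α ≡ᵇ rcv β) ∨ (rcv α ≡ᵇ snd β) ∨ (rcv α ≡ᵇ rcv β)

meets : Comm → Trace → Bool
meets α = any (shares α)

_∘ᶜ_ : Comm → Trace → Trace
α ∘ᶜ σ = if meets α σ then α ∷ σ else σ

ev : Trace → Comm → Trace
ev σ α = foldr _∘ᶜ_ (α ∷ []) σ

IsEv : GType → Trace → Set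
IsEv G τ = ∃[ σ ] ∃[ α ] (Tr G (σ ∷ʳ α) × τ ∼ ev σ α)

_≤g_ : Trace → Trace → Set
τ ≤g τ' = ∃[ σ ] ∃[ σ' ] (σ ∼ τ × (σ ++ σ') ∼ τ')

_#g_ : Trace → Trace → Set
τ #g τ' = ∃[ σ ] ∃[ p ] ∃[ q ] ∃[ l₁ ] ∃[ l₂ ] ∃[ σ₁ ] ∃[ σ₂ ]
          (l₁ ≢ l₂ × τ ∼ (σ ++ comm p q l₁ ∷ σ₁) × τ' ∼ (σ ++ comm p q l₂ ∷ σ₂))

record ES : Set₁ where
  field
    Event : Set
    _≈_   : Event → Event → Set
    _≤ₑ_  : Event → Event → Set
    _#_   : Event → Event → Set

S : GType → ES
S G = record
  { Event = Σ Trace (IsEv G)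
  ; _≈_   = λ e e' → proj₁ e ∼ proj₁ e'
  ; _≤ₑ_  = λ e e' → proj₁ e ≤g proj₁ e'
  ; _#_   = λ e e' → proj₁ e #g proj₁ e'
  }

record Iso (A B : ES) : Set where
  private
    module A = ES A
    module B = ES B
  field
    to       : A.Event → B.Event
    from     : B.Event → A.Event
    to-cong  : ∀ {e e'} → e A.≈ e' → to e B.≈ to e'
    from-cong : ∀ {e e'} → e B.≈ e' → from e A.≈ from e'
    from-to  : ∀ e → from (to e) A.≈ e
    to-from  : ∀ e → to (from e) B.≈ e
    ≤-pres   : ∀ {e e'} → e A.≤ₑ e' → to e B.≤ₑ to e'
    ≤-refl   : ∀ {e e'} → to e B.≤ₑ to e' → e A.≤ₑ e'
    #-pres   : ∀ {e e'} → e A.# e' → to e B.# to e'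
    #-refl   : ∀ {e e'} → to e B.# to e' → e A.# e'

-- The isomorphism is the identity on trace representatives, so it suffices that every
-- event ev σ α of G is, up to ∼, an event of G′.  Each process of N agrees with the
-- projections of G along any path, hence can run σ·α locally.  We replay σ·α top-down
-- in G′: at a node p → q the processes of p and q offer exactly that output and input,
-- so the first communication of σ·α involving p or q is a p → q message, and moving it
-- to the front does not change the event.  If no communication involves p or q we
-- follow any branch; boundedness of G′ guarantees that this happens only finitely often
-- before the sender of α is met.

module Submission where

open import Defs

open import Algebra.Bundles using (CommutativeMonoid)
open import Data.Bool using (true; false; _∨_; T)
open import Data.Bool.Properties using (∨-conicalˡ; ∨-conicalʳ; ∨-commutativeMonoid)
open import Algebra.Properties.CommutativeSemigroup
  (CommutativeMonoid.commutativeSemigroup ∨-commutativeMonoid) using (x∙yz≈y∙xz)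
open import Data.Fin using (Fin)
open import Data.List using (List; []; _∷_; _++_; _∷ʳ_; foldr; length; map)
open import Data.List.Membership.Propositional using (_∈_; _∉_)
open import Data.List.Membership.Propositional.Properties using (∈-map⁺; ∈-map⁻)
open import Data.List.Properties using (++-assoc; ++-conicalʳ; foldr-++; length-++-sucʳ)
open import Data.List.Relation.Unary.All as All using (All; []; _∷_)
open import Data.List.Relation.Unary.All.Properties using (∷ʳ⁺)
open import Data.List.Relation.Unary.AllPairs using (_∷_)
open import Data.List.Relation.Unary.Any using (here; there)
open import Data.List.Relation.Unary.First using (first) renaming (_++_∷_ to first-at)
open import Data.List.Relation.Unary.First.Properties using (toView)
open import Data.List.Relation.Unary.Unique.Propositional using (Unique)
open import Data.Nat using (ℕ; zero; suc; pred; _≡ᵇ_; _≤_; z≤n; s≤s⁻¹)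
open import Data.Nat.Properties using (_≟_; ≡⇒≡ᵇ; ≤-refl; ≤-trans; pred-mono-≤; n≤0⇒n≡0)
open import Data.List.Membership.DecPropositional _≟_ using (_∈?_)
open import Data.Product using (Σ; ∃-syntax; _×_; _,_; proj₁; proj₂; map₂)
open import Data.Sum using (_⊎_; inj₁; inj₂)
open import Data.Unit using (⊤; tt)
open import Function using (_∘_; id)
open import Relation.Binary.PropositionalEquality
open import Relation.Nullary using (¬_; Dec; yes; no; contradiction)
open import Relation.Nullary.Decidable using (dec-false; toSum)

≡ᵇ≡false⇒≢ : ∀ {m n} → (m ≡ᵇ n) ≡ false → m ≢ n
≡ᵇ≡false⇒≢ {m} {n} e m≡n = subst T e (≡⇒≡ᵇ m n m≡n)

shares≡false⇒Disjoint : ∀ α β → shares α β ≡ false → Disjoint α β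
shares≡false⇒Disjoint α β e = apart
  where
  e₂ : ((snd α ≡ᵇ rcv β) ∨ (rcv α ≡ᵇ snd β) ∨ (rcv α ≡ᵇ rcv β)) ≡ false
  e₂ = ∨-conicalʳ (snd α ≡ᵇ snd β) _ e
  e₃ : ((rcv α ≡ᵇ snd β) ∨ (rcv α ≡ᵇ rcv β)) ≡ false
  e₃ = ∨-conicalʳ (snd α ≡ᵇ rcv β) _ e₂
  apart : Disjoint α β
  apart x (here x≡s) (here x≡s′) =
    ≡ᵇ≡false⇒≢ (∨-conicalˡ _ _ e) (trans (sym x≡s) x≡s′)
  apart x (here x≡s) (there (here x≡r′)) =
    ≡ᵇ≡false⇒≢ (∨-conicalˡ _ _ e₂) (trans (sym x≡s) x≡r′)
  apart x (there (here x≡r)) (here x≡s′) =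
    ≡ᵇ≡false⇒≢ (∨-conicalˡ _ _ e₃) (trans (sym x≡r) x≡s′)
  apart x (there (here x≡r)) (there (here x≡r′)) =
    ≡ᵇ≡false⇒≢ (∨-conicalʳ _ _ e₃) (trans (sym x≡r) x≡r′)

Disjoint⇒shares≡false : ∀ α β → Disjoint α β → shares α β ≡ false
Disjoint⇒shares≡false α β α#β =
  cong₂ _∨_ (apart (here refl) (here refl))
    (cong₂ _∨_ (apart (here refl) (there (here refl)))
      (cong₂ _∨_ (apart (there (here refl)) (here refl))
        (apart (there (here refl)) (there (here refl)))))
  where
  apart : ∀ {x y} → x ∈ partC α → y ∈ partC β → (x ≡ᵇ y) ≡ false
  apart {x} {y} x∈α y∈β = dec-false (x ≟ y) λ x≡y → α#β x x∈α (subst (_∈ partC β) (sym x≡y) y∈β)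

Disjoint-sym : ∀ α β → Disjoint α β → Disjoint β α
Disjoint-sym α β α#β x x∈β x∈α = α#β x x∈α x∈β

disjoint? : ∀ α β → Dec (Disjoint α β)
disjoint? α β with shares α β in e
... | false = yes (shares≡false⇒Disjoint α β e)
... | true  = no λ α#β → contradiction (trans (sym e) (Disjoint⇒shares≡false α β α#β)) λ ()

All-Disjoint⇒meets≡false : ∀ α {σ} → All (Disjoint α) σ → meets α σ ≡ false
All-Disjoint⇒meets≡false α [] = refl
All-Disjoint⇒meets≡false α {β ∷ _} (α#β ∷ α#σ) =
  cong₂ _∨_ (Disjoint⇒shares≡false α β α#β) (All-Disjoint⇒meets≡false α α#σ)

All-Disjoint⇒snd∉ : ∀ α {τ} → All (Disjoint α) τ → All ((snd α ∉_) ∘ partC) τ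
All-Disjoint⇒snd∉ α = All.map λ α#β → α#β (snd α) (here refl)

All-Disjoint⇒rcv∉ : ∀ α {τ} → All (Disjoint α) τ → All ((rcv α ∉_) ∘ partC) τ
All-Disjoint⇒rcv∉ α = All.map λ α#β → α#β (rcv α) (there (here refl))

∉∉⇒Disjoint : ∀ {p q} l γ → p ∉ partC γ → q ∉ partC γ → Disjoint (comm p q l) γ
∉∉⇒Disjoint l γ p∉γ q∉γ _ (here refl)         = p∉γ
∉∉⇒Disjoint l γ p∉γ q∉γ _ (there (here refl)) = q∉γ

∉-pair : ∀ {r p q : Participant} → r ≢ p → r ≢ q → r ∉ p ∷ q ∷ []
∉-pair r≢p r≢q (here r≡p)         = r≢p r≡p
∉-pair r≢p r≢q (there (here r≡q)) = r≢q r≡q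

data Prefixed (α : Comm) (σ : Trace) : Trace → Set where
  linked : meets α σ ≡ true  → Prefixed α σ (α ∷ σ)
  apart  : meets α σ ≡ false → Prefixed α σ σ

prefixed : ∀ α σ → Prefixed α σ (α ∘ᶜ σ)
prefixed α σ with meets α σ in e
... | true  = linked e
... | false = apart e

∘ᶜ-linked : ∀ α σ → meets α σ ≡ true → (α ∘ᶜ σ) ≡ α ∷ σ
∘ᶜ-linked α σ e rewrite e = refl

∘ᶜ-apart : ∀ α σ → meets α σ ≡ false → (α ∘ᶜ σ) ≡ σ
∘ᶜ-apart α σ e rewrite e = refl

meets-∷-Disjoint : ∀ β γ X → Disjoint β γ → meets β (γ ∷ X) ≡ meets β X
meets-∷-Disjoint β γ X β#γ = cong (_∨ meets β X) (Disjoint⇒shares≡false β γ β#γ)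

∼-∷⁺ : ∀ α {σ τ} → σ ∼ τ → (α ∷ σ) ∼ (α ∷ τ)
∼-∷⁺ α ∼-refl = ∼-refl
∼-∷⁺ α (∼-sym σ∼τ) = ∼-sym (∼-∷⁺ α σ∼τ)
∼-∷⁺ α (∼-trans σ∼ρ ρ∼τ) = ∼-trans (∼-∷⁺ α σ∼ρ) (∼-∷⁺ α ρ∼τ)
∼-∷⁺ α (∼-swap σ β γ σ′ β#γ) = ∼-swap (α ∷ σ) β γ σ′ β#γ

∼-reflexive : ∀ {σ τ} → σ ≡ τ → σ ∼ τ
∼-reflexive refl = ∼-refl

meets-resp-∼ : ∀ α {σ τ} → σ ∼ τ → meets α σ ≡ meets α τ
meets-resp-∼ α ∼-refl = refl
meets-resp-∼ α (∼-sym σ∼τ) = sym (meets-resp-∼ α σ∼τ)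
meets-resp-∼ α (∼-trans σ∼ρ ρ∼τ) = trans (meets-resp-∼ α σ∼ρ) (meets-resp-∼ α ρ∼τ)
meets-resp-∼ α (∼-swap σ β γ σ′ _) = meets-swap σ
  where
  meets-swap : ∀ ρ → meets α (ρ ++ β ∷ γ ∷ σ′) ≡ meets α (ρ ++ γ ∷ β ∷ σ′)
  meets-swap []      = x∙yz≈y∙xz (shares α β) (shares α γ) (meets α σ′)
  meets-swap (δ ∷ ρ) = cong (shares α δ ∨_) (meets-swap ρ)

∘ᶜ-resp-∼ : ∀ α {σ τ} → σ ∼ τ → (α ∘ᶜ σ) ∼ (α ∘ᶜ τ)
∘ᶜ-resp-∼ α {σ} {τ} σ∼τ with meets α σ | meets α τ | meets-resp-∼ α σ∼τ
... | true  | .true  | refl = ∼-∷⁺ α σ∼τ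
... | false | .false | refl = σ∼τ

∘ᶜ-comm : ∀ β γ X → Disjoint β γ → (β ∘ᶜ (γ ∘ᶜ X)) ∼ (γ ∘ᶜ (β ∘ᶜ X))
∘ᶜ-comm β γ X β#γ = by-cases (prefixed β X) (prefixed γ X)
  where
  β-skips-γ : meets β (γ ∷ X) ≡ meets β X
  β-skips-γ = meets-∷-Disjoint β γ X β#γ
  γ-skips-β : meets γ (β ∷ X) ≡ meets γ X
  γ-skips-β = meets-∷-Disjoint γ β X (Disjoint-sym β γ β#γ)
  by-cases : ∀ {βX γX} → Prefixed β X βX → Prefixed γ X γX → (β ∘ᶜ γX) ∼ (γ ∘ᶜ βX)
  by-cases (linked b) (linked g) =
    subst₂ _∼_ (sym (∘ᶜ-linked β (γ ∷ X) (trans β-skips-γ b)))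
               (sym (∘ᶜ-linked γ (β ∷ X) (trans γ-skips-β g)))
               (∼-swap [] β γ X β#γ)
  by-cases (linked b) (apart g) =
    subst₂ _∼_ (sym (∘ᶜ-linked β X b)) (sym (∘ᶜ-apart γ (β ∷ X) (trans γ-skips-β g))) ∼-refl
  by-cases (apart b) (linked g) =
    subst₂ _∼_ (sym (∘ᶜ-apart β (γ ∷ X) (trans β-skips-γ b))) (sym (∘ᶜ-linked γ X g)) ∼-refl
  by-cases (apart b) (apart g) =
    subst₂ _∼_ (sym (∘ᶜ-apart β X b)) (sym (∘ᶜ-apart γ X g)) ∼-refl

foldr-∘ᶜ-resp-∼ : ∀ σ {X Y} → X ∼ Y → foldr _∘ᶜ_ X σ ∼ foldr _∘ᶜ_ Y σ
foldr-∘ᶜ-resp-∼ []      X∼Y = X∼Y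
foldr-∘ᶜ-resp-∼ (δ ∷ σ) X∼Y = ∘ᶜ-resp-∼ δ (foldr-∘ᶜ-resp-∼ σ X∼Y)

ev-resp-∼ : ∀ {σ τ} α → σ ∼ τ → ev σ α ∼ ev τ α
ev-resp-∼ α ∼-refl = ∼-refl
ev-resp-∼ α (∼-sym σ∼τ) = ∼-sym (ev-resp-∼ α σ∼τ)
ev-resp-∼ α (∼-trans σ∼ρ ρ∼τ) = ∼-trans (ev-resp-∼ α σ∼ρ) (ev-resp-∼ α ρ∼τ)
ev-resp-∼ α (∼-swap σ β γ σ′ β#γ) =
  subst₂ _∼_ (sym (foldr-++ _∘ᶜ_ (α ∷ []) σ (β ∷ γ ∷ σ′)))
             (sym (foldr-++ _∘ᶜ_ (α ∷ []) σ (γ ∷ β ∷ σ′)))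
             (foldr-∘ᶜ-resp-∼ σ (∘ᶜ-comm β γ (ev σ′ α) β#γ))

∼-move-front : ∀ γ ρ τ → All (Disjoint γ) ρ → (ρ ++ γ ∷ τ) ∼ (γ ∷ ρ ++ τ)
∼-move-front γ []      τ []          = ∼-refl
∼-move-front γ (δ ∷ ρ) τ (γ#δ ∷ γ#ρ) =
  ∼-trans (∼-∷⁺ δ (∼-move-front γ ρ τ γ#ρ)) (∼-swap [] δ γ (ρ ++ τ) (Disjoint-sym γ δ γ#δ))

ev-apart : ∀ α ρ → All (Disjoint α) ρ → ev ρ α ≡ α ∷ []
ev-apart α []      []          = refl
ev-apart α (δ ∷ ρ) (α#δ ∷ α#ρ) =
  trans (cong (δ ∘ᶜ_) (ev-apart α ρ α#ρ))
        (∘ᶜ-apart δ (α ∷ []) (All-Disjoint⇒meets≡false δ {α ∷ []} (Disjoint-sym α δ α#δ ∷ [])))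

All-ev : ∀ {P : Comm → Set} σ α → All P σ → P α → All P (ev σ α)
All-ev []      α []        pα = pα ∷ []
All-ev (δ ∷ σ) α (pδ ∷ pσ) pα with meets δ (ev σ α)
... | true  = pδ ∷ All-ev σ α pσ pα
... | false = All-ev σ α pσ pα

-- Local runs of processes

data Run (P : PType) (r : Participant) : Fin (psize P) → Trace → Fin (psize P) → Set where
  []   : ∀ {m} → Run P r m [] m
  skip : ∀ {m α σ m′} → r ∉ partC α → Run P r m σ m′ → Run P r m (α ∷ σ) m′
  send : ∀ {m α σ m′ ps m₁} → r ≡ snd α → pnode P m ≡ out (rcv α) ps → (lab α , m₁) ∈ ps →
         Run P r m₁ σ m′ → Run P r m (α ∷ σ) m′
  recv : ∀ {m α σ m′ ps m₁} → r ≡ rcv α → pnode P m ≡ inp (snd α) ps → (lab α , m₁) ∈ ps →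
         Run P r m₁ σ m′ → Run P r m (α ∷ σ) m′

out≢inact : ∀ {n} {x : PNode n} {q ps} → x ≡ out q ps → x ≢ inact
out≢inact refl ()

inp≢inact : ∀ {n} {x : PNode n} {p ps} → x ≡ inp p ps → x ≢ inact
inp≢inact refl ()

module _ {P : PType} {r : Participant} where

  run-++⁻ : ∀ σ {τ m m′} → Run P r m (σ ++ τ) m′ → ∃[ m₁ ] (Run P r m σ m₁ × Run P r m₁ τ m′)
  run-++⁻ []      run = _ , [] , run
  run-++⁻ (_ ∷ σ) (skip r∉α run) =
    let m₁ , run₁ , run₂ = run-++⁻ σ run in m₁ , skip r∉α run₁ , run₂
  run-++⁻ (_ ∷ σ) (send r≡s eP m₁∈ run) =
    let m₁ , run₁ , run₂ = run-++⁻ σ run in m₁ , send r≡s eP m₁∈ run₁ , run₂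
  run-++⁻ (_ ∷ σ) (recv r≡r eP m₁∈ run) =
    let m₁ , run₁ , run₂ = run-++⁻ σ run in m₁ , recv r≡r eP m₁∈ run₁ , run₂

  run-++⁺ : ∀ {σ τ m m₁ m′} → Run P r m σ m₁ → Run P r m₁ τ m′ → Run P r m (σ ++ τ) m′
  run-++⁺ []                    run′ = run′
  run-++⁺ (skip r∉α run)        run′ = skip r∉α (run-++⁺ run run′)
  run-++⁺ (send r≡s eP m₁∈ run) run′ = send r≡s eP m₁∈ (run-++⁺ run run′)
  run-++⁺ (recv r≡r eP m₁∈ run) run′ = recv r≡r eP m₁∈ (run-++⁺ run run′)

  run-idle : ∀ {σ m} → All ((r ∉_) ∘ partC) σ → Run P r m σ m
  run-idle []          = []
  run-idle (r∉α ∷ r∉σ) = skip r∉α (run-idle r∉σ)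

  run-idle⁻ : ∀ {σ m m′} → All ((r ∉_) ∘ partC) σ → Run P r m σ m′ → m′ ≡ m
  run-idle⁻ []        []               = refl
  run-idle⁻ (_ ∷ r∉σ) (skip _ run)     = run-idle⁻ r∉σ run
  run-idle⁻ (r∉α ∷ _) (send r≡s _ _ _) = contradiction (here r≡s) r∉α
  run-idle⁻ (r∉α ∷ _) (recv r≡r _ _ _) = contradiction (there (here r≡r)) r∉α

  run-++-idle⁻ : ∀ ρ {τ m m′} → All ((r ∉_) ∘ partC) ρ → Run P r m (ρ ++ τ) m′ → Run P r m τ m′
  run-++-idle⁻ ρ r∉ρ run with run-++⁻ ρ run
  ... | _ , run₁ , run₂ rewrite run-idle⁻ r∉ρ run₁ = run₂

  run-drop : ∀ ρ {γ τ m m′} → r ∉ partC γ → Run P r m (ρ ++ γ ∷ τ) m′ → Run P r m (ρ ++ τ) m′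
  run-drop ρ r∉γ run with run-++⁻ ρ run
  ... | _ , run₁ , skip _ run₂     = run-++⁺ run₁ run₂
  ... | _ , _    , send r≡s _ _ _ = contradiction (here r≡s) r∉γ
  ... | _ , _    , recv r≡r _ _ _ = contradiction (there (here r≡r)) r∉γ

  run-active : ∀ σ {α m m′} → r ∈ partC α → Run P r m (σ ∷ʳ α) m′ → pnode P m ≢ inact
  run-active []      r∈α (skip r∉α _)    = contradiction r∈α r∉α
  run-active (_ ∷ σ) r∈α (skip _ run)    = run-active σ r∈α run
  run-active []      _   (send _ eP _ _) = out≢inact eP
  run-active (_ ∷ _) _   (send _ eP _ _) = out≢inact eP
  run-active []      _   (recv _ eP _ _) = inp≢inact eP
  run-active (_ ∷ _) _   (recv _ eP _ _) = inp≢inact eP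

  run-out-∷ : ∀ {m γ τ m′ q ps} → pnode P m ≡ out q ps → Run P r m (γ ∷ τ) m′ →
    r ∉ partC γ ⊎ (r ≡ snd γ × rcv γ ≡ q × ∃[ m₁ ] ((lab γ , m₁) ∈ ps × Run P r m₁ τ m′))
  run-out-∷ eP (skip r∉γ _) = inj₁ r∉γ
  run-out-∷ eP (send r≡s eP′ m₁∈ run) with trans (sym eP′) eP
  ... | refl = inj₂ (r≡s , refl , _ , m₁∈ , run)
  run-out-∷ eP (recv _ eP′ _ _) = contradiction (trans (sym eP′) eP) λ ()

  run-inp-∷ : ∀ {m γ τ m′ p ps} → pnode P m ≡ inp p ps → Run P r m (γ ∷ τ) m′ →
    r ∉ partC γ ⊎ (r ≡ rcv γ × snd γ ≡ p × ∃[ m₁ ] ((lab γ , m₁) ∈ ps × Run P r m₁ τ m′))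
  run-inp-∷ eP (skip r∉γ _) = inj₁ r∉γ
  run-inp-∷ eP (send _ eP′ _ _) = contradiction (trans (sym eP′) eP) λ ()
  run-inp-∷ eP (recv r≡r eP′ m₁∈ run) with trans (sym eP′) eP
  ... | refl = inj₂ (r≡r , refl , _ , m₁∈ , run)

branch-functional : ∀ {A : Set} {bs : List (Label × A)} {l a b} →
                    Unique (map proj₁ bs) → (l , a) ∈ bs → (l , b) ∈ bs → a ≡ b
branch-functional _         (here refl) (here refl) = refl
branch-functional (l∉ ∷ _)  (here refl) (there b∈)  =
  contradiction refl (All.lookup l∉ (∈-map⁺ proj₁ b∈))
branch-functional (l∉ ∷ _)  (there a∈)  (here refl) =
  contradiction refl (All.lookup l∉ (∈-map⁺ proj₁ a∈))
branch-functional (_ ∷ uniq) (there a∈) (there b∈)  = branch-functional uniq a∈ b∈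

some-member : ∀ {A : Set} {xs : List A} → xs ≢ [] → ∃[ x ] (x ∈ xs)
some-member {xs = []}    xs≢[] = contradiction refl xs≢[]
some-member {xs = x ∷ _} _     = x , here refl

∷ʳ≢[] : ∀ (σ : Trace) α → σ ∷ʳ α ≢ []
∷ʳ≢[] σ α σα≡[] = contradiction (++-conicalʳ σ (α ∷ []) σα≡[]) λ ()

depth-∷-∉ : ∀ {r} β τ → r ∉ partC β → depth r τ ≤ pred (depth r (β ∷ τ))
depth-∷-∉ {r} β τ r∉β
  rewrite dec-false (r ≟ snd β) (λ r≡s → r∉β (here r≡s))
        | dec-false (r ≟ rcv β) (λ r≡r → r∉β (there (here r≡r)))
  with depth r τ
... | zero  = z≤n
... | suc _ = ≤-refl

depth-≢0 : ∀ {r} τ → r ∈ partT τ → depth r τ ≢ 0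
depth-≢0 {r} (β ∷ τ) r∈ with (r ≡ᵇ snd β) ∨ (r ≡ᵇ rcv β) in e
... | true  = λ ()
... | false with depth r τ in d
...   | suc _ = λ ()
...   | zero  = contradiction d (depth-≢0 τ (r∈τ r∈))
  where
  r∈τ : r ∈ snd β ∷ rcv β ∷ partT τ → r ∈ partT τ
  r∈τ (here r≡s)         = contradiction r≡s (≡ᵇ≡false⇒≢ (∨-conicalˡ _ _ e))
  r∈τ (there (here r≡r)) = contradiction r≡r (≡ᵇ≡false⇒≢ (∨-conicalʳ _ _ e))
  r∈τ (there (there r∈)) = r∈

Reach : (G : GType) → Fin (gsize G) → Set
Reach G s = ∃[ π ] Path G (groot G) π s

DepthBound : (G : GType) → Fin (gsize G) → Participant → ℕ → Set
DepthBound G s r n = ∀ τ → TrAt G s τ → depth r τ ≤ n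

module _ {G : GType} where

  path-∷ʳ : ∀ {a π b p q gs l s₁} → Path G a π b → gnode G b ≡ com p q gs → (l , s₁) ∈ gs →
            Path G a (π ∷ʳ comm p q l) s₁
  path-∷ʳ nil            e s₁∈ = cons e s₁∈ nil
  path-∷ʳ (cons e′ t∈ π) e s₁∈ = cons e′ t∈ (path-∷ʳ π e s₁∈)

  reach-step : ∀ {s p q gs l s₁} → Reach G s → gnode G s ≡ com p q gs → (l , s₁) ∈ gs →
               Reach G s₁
  reach-step (π , path) e s₁∈ = _ , path-∷ʳ path e s₁∈

  ok-at : IsGlobalType G → ∀ {s p q gs} → Reach G s → gnode G s ≡ com p q gs → OKG (com p q gs)
  ok-at G-ok (π , path) e = subst OKG e (G-ok π _ path)

  PartAt-child : ∀ {s p q gs l s₁ r} → gnode G s ≡ com p q gs → (l , s₁) ∈ gs →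
                 PartAt G s₁ r → PartAt G s r
  PartAt-child e s₁∈ (τ , (_ , t , path) , r∈τ) =
    comm _ _ _ ∷ τ , ((λ ()) , t , cons e s₁∈ path) , there (there r∈τ)

  PartAt-com : ∀ {s p q gs r} → gs ≢ [] → gnode G s ≡ com p q gs → r ∈ p ∷ q ∷ [] →
               PartAt G s r
  PartAt-com {gs = []}            gs≢[] _ _  = contradiction refl gs≢[]
  PartAt-com {gs = (l , s₁) ∷ _} _     e r∈ =
    comm _ _ l ∷ [] , ((λ ()) , s₁ , cons e (here refl) nil) , r∈

  PartAt-end : ∀ {s r} → gnode G s ≡ end → ¬ PartAt G s r
  PartAt-end e (_ , (τ≢[] , _ , nil)         , _) = τ≢[] refl
  PartAt-end e (_ , (_    , _ , cons e′ _ _) , _) = contradiction (trans (sym e) e′) λ ()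

  DepthBound-child : ∀ {s p q gs l s₁ r n} → gnode G s ≡ com p q gs → (l , s₁) ∈ gs →
                     r ∉ p ∷ q ∷ [] → DepthBound G s r (suc n) → DepthBound G s₁ r n
  DepthBound-child {p = p} {q} {l = l} e s₁∈ r∉ bound τ (_ , t , path) =
    ≤-trans (depth-∷-∉ (comm p q l) τ r∉)
            (pred-mono-≤ (bound (comm p q l ∷ τ) ((λ ()) , t , cons e s₁∈ path)))

  DepthBound-zero : ∀ {s r} → DepthBound G s r 0 → ¬ PartAt G s r
  DepthBound-zero bound (τ , tr , r∈τ) = depth-≢0 τ r∈τ (n≤0⇒n≡0 (bound τ tr))

module _ {G : GType} {Q : PType} {R : Fin (gsize G) → Fin (psize Q) → Set}
         {s : Fin (gsize G)} {t : Fin (psize Q)} {p q : Participant}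
         {gs : List (Label × Fin (gsize G))} (e : gnode G s ≡ com p q gs) where

  ProjStep-sender : PartAt G s p → p ≢ q → ProjStep G p Q R s t →
                    ∃[ qs ] (pnode Q t ≡ out q qs × BrRel R gs qs)
  ProjStep-sender part _ (pj-0 ¬part _) = contradiction part ¬part
  ProjStep-sender _ p≢q (pj-in e′ _ p≡q _ _) with trans (sym e) e′
  ... | refl = contradiction p≡q p≢q
  ProjStep-sender _ _ (pj-out e′ _ _ _ eQ br) with trans (sym e) e′
  ... | refl = _ , eQ , br
  ProjStep-sender _ _ (pj-skip e′ _ p≢p _ _ _) with trans (sym e) e′
  ... | refl = contradiction refl p≢p

  ProjStep-receiver : PartAt G s q → p ≢ q → ProjStep G q Q R s t →
                      ∃[ qs ] (pnode Q t ≡ inp p qs × BrRel R gs qs)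
  ProjStep-receiver part _ (pj-0 ¬part _) = contradiction part ¬part
  ProjStep-receiver _ _ (pj-in e′ _ _ eQ br) with trans (sym e) e′
  ... | refl = _ , eQ , br
  ProjStep-receiver _ p≢q (pj-out e′ _ q≡p _ _ _) with trans (sym e) e′
  ... | refl = contradiction (sym q≡p) p≢q
  ProjStep-receiver _ _ (pj-skip e′ _ _ q≢q _ _) with trans (sym e) e′
  ... | refl = contradiction refl q≢q

  ProjStep-bystander : ∀ {r} → r ≢ p → r ≢ q → ProjStep G r Q R s t →
    (¬ PartAt G s r × pnode Q t ≡ inact) ⊎ (∀ {l s₁} → (l , s₁) ∈ gs → R s₁ t)
  ProjStep-bystander _ _ (pj-0 ¬part eQ) = inj₁ (¬part , eQ)
  ProjStep-bystander _ r≢q (pj-in e′ _ r≡q _ _) with trans (sym e) e′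
  ... | refl = contradiction r≡q r≢q
  ProjStep-bystander r≢p _ (pj-out e′ _ r≡p _ _ _) with trans (sym e) e′
  ... | refl = contradiction r≡p r≢p
  ProjStep-bystander _ _ (pj-skip e′ _ _ _ _ stay) with trans (sym e) e′
  ... | refl = inj₂ stay

module _ {P Q : PType} {R : Fin (psize P) → Fin (psize Q) → Set}
         {m : Fin (psize P)} {t : Fin (psize Q)} where

  LeStep-inact : LeStep P Q R m t → pnode Q t ≡ inact → pnode P m ≡ inact
  LeStep-inact (le-0 eP _)         _  = eP
  LeStep-inact (le-in _ eQ′ _)     eQ = contradiction eQ (inp≢inact eQ′)
  LeStep-inact (le-out _ eQ′ _ _)  eQ = contradiction eQ (out≢inact eQ′)

  LeStep-out : ∀ {q qs} → LeStep P Q R m t → pnode Q t ≡ out q qs →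
    ∃[ ps ] (pnode P m ≡ out q ps ×
             (∀ {l t₁} → (l , t₁) ∈ qs → ∃[ m₁ ] ((l , m₁) ∈ ps × R m₁ t₁)) ×
             (∀ {l m₁} → (l , m₁) ∈ ps → ∃[ t₁ ] ((l , t₁) ∈ qs)))
  LeStep-out (le-0 _ eQ′)    eQ = contradiction eQ′ (out≢inact eQ)
  LeStep-out (le-in _ eQ′ _) eQ = contradiction (trans (sym eQ′) eQ) λ ()
  LeStep-out (le-out eP eQ′ fwd bwd) eQ with trans (sym eQ′) eQ
  ... | refl = _ , eP , fwd , bwd

  LeStep-inp : ∀ {p qs} → LeStep P Q R m t → pnode Q t ≡ inp p qs →
    ∃[ ps ] (pnode P m ≡ inp p ps × (∀ {l t₁} → (l , t₁) ∈ qs → ∃[ m₁ ] ((l , m₁) ∈ ps × R m₁ t₁)))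
  LeStep-inp (le-0 _ eQ′)       eQ = contradiction eQ′ (inp≢inact eQ)
  LeStep-inp (le-out _ eQ′ _ _) eQ = contradiction (trans (sym eQ′) eQ) λ ()
  LeStep-inp (le-in eP eQ′ fwd) eQ with trans (sym eQ′) eQ
  ... | refl = _ , eP , fwd

record Conforms (G : GType) (r : Participant) (P : PType) : Set₁ where
  field
    Q       : PType
    R↾      : Fin (gsize G) → Fin (psize Q) → Set
    R≤      : Fin (psize P) → Fin (psize Q) → Set
    R↾-root : R↾ (groot G) (proot Q)
    R↾-step : ∀ s t → R↾ s t → ProjStep G r Q R↾ s t
    R≤-root : R≤ (proot P) (proot Q)
    R≤-step : ∀ m t → R≤ m t → LeStep P Q R≤ m t

conforms : ∀ {G r P Q} → Proj G r Q → P ≤P Q → Conforms G r P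
conforms {Q = Q} (R↾ , R↾-root , R↾-step) (R≤ , R≤-root , R≤-step) =
  record { Q = Q ; R↾ = R↾ ; R≤ = R≤ ; R↾-root = R↾-root ; R↾-step = R↾-step
         ; R≤-root = R≤-root ; R≤-step = R≤-step }

idle : PType
idle = record { psize = 1 ; proot = Fin.zero ; pnode = λ _ → inact }

conforms-absent : ∀ {G r} → ¬ PartAt G (groot G) r → Conforms G r idle
conforms-absent {G} {r} ¬part =
  record { Q = idle ; R↾ = λ s _ → ¬ PartAt G s r ; R≤ = λ _ _ → ⊤
         ; R↾-root = ¬part ; R↾-step = λ _ _ ¬part′ → pj-0 ¬part′ refl
         ; R≤-root = tt ; R≤-step = λ _ _ _ → le-0 refl refl }

network-processes : ∀ {N G G′} → IsNetwork N → N ⊢ G → N ⊢ G′ →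
  ∀ r → Σ PType λ P → IsProcess P × Conforms G r P × Conforms G′ r P
network-processes {N} (_ , _ , N-ok) ⊢G ⊢G′ r with r ∈? names N
... | no r∉N =
  idle , (λ _ _ → tt) , conforms-absent (r∉N ∘ proj₂ ⊢G r) , conforms-absent (r∉N ∘ proj₂ ⊢G′ r)
... | yes r∈N with ∈-map⁻ proj₁ r∈N
...   | (_ , P) , rP∈N , refl =
  let _ , ↾Q , P≤Q = proj₁ ⊢G rP∈N
      _ , ↾Q′ , P≤Q′ = proj₁ ⊢G′ rP∈N
  in P , All.lookup N-ok rP∈N , conforms ↾Q P≤Q , conforms ↾Q′ P≤Q′

-- Agreement of process states with nodes

module Agreement (G : GType) (G-ok : IsGlobalType G) (P : Participant → PType)
                 (conf : ∀ r → Conforms G r (P r)) where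

  private module C r = Conforms (conf r)

  Agrees : (r : Participant) → Fin (psize (P r)) → Fin (gsize G) → Set
  Agrees r m s = (¬ PartAt G s r × pnode (P r) m ≡ inact) ⊎ (∃[ t ] (C.R↾ r s t × C.R≤ r m t))

  Follows : (r : Participant) →
            List (Label × Fin (psize (P r))) → List (Label × Fin (gsize G)) → Set
  Follows r ps gs = ∀ {l s₁} → (l , s₁) ∈ gs → ∃[ m₁ ] ((l , m₁) ∈ ps × Agrees r m₁ s₁)

  agrees-root : ∀ r → Agrees r (proot (P r)) (groot G)
  agrees-root r = inj₂ (_ , C.R↾-root r , C.R≤-root r)

  follows : ∀ {r gs qs ps} →
            (∀ {l s₁} → (l , s₁) ∈ gs → ∃[ t₁ ] ((l , t₁) ∈ qs × C.R↾ r s₁ t₁)) →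
            (∀ {l t₁} → (l , t₁) ∈ qs → ∃[ m₁ ] ((l , m₁) ∈ ps × C.R≤ r m₁ t₁)) →
            Follows r ps gs
  follows fwd↾ fwd≤ s₁∈ =
    let t₁ , t₁∈ , ↾₁ = fwd↾ s₁∈
        m₁ , m₁∈ , ≤₁ = fwd≤ t₁∈
    in m₁ , m₁∈ , inj₂ (t₁ , ↾₁ , ≤₁)

  sender-step : ∀ {s p q gs m} → Reach G s → gnode G s ≡ com p q gs → Agrees p m s →
    ∃[ ps ] (pnode (P p) m ≡ out q ps × Follows p ps gs ×
             (∀ {l m₁} → (l , m₁) ∈ ps → ∃[ s₁ ] ((l , s₁) ∈ gs)))
  sender-step R e agrees with ok-at G-ok R e
  ... | p≢q , gs≢[] , _ with agrees
  ...   | inj₁ (¬part , _) = contradiction (PartAt-com gs≢[] e (here refl)) ¬part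
  ...   | inj₂ (t , ↾ , ≤) =
    let _ , eQ , fwd↾ , bwd↾ = ProjStep-sender e (PartAt-com gs≢[] e (here refl)) p≢q
                                 (C.R↾-step _ _ t ↾)
        ps , eP , fwd≤ , bwd≤ = LeStep-out (C.R≤-step _ _ t ≤) eQ
    in ps , eP , follows fwd↾ fwd≤ , λ m₁∈ → bwd↾ (proj₂ (bwd≤ m₁∈))

  receiver-step : ∀ {s p q gs m} → Reach G s → gnode G s ≡ com p q gs → Agrees q m s →
    ∃[ ps ] (pnode (P q) m ≡ inp p ps × Follows q ps gs)
  receiver-step R e agrees with ok-at G-ok R e
  ... | p≢q , gs≢[] , _ with agrees
  ...   | inj₁ (¬part , _) = contradiction (PartAt-com gs≢[] e (there (here refl))) ¬part
  ...   | inj₂ (t , ↾ , ≤) =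
    let _ , eQ , fwd↾ , _ = ProjStep-receiver e (PartAt-com gs≢[] e (there (here refl))) p≢q
                              (C.R↾-step _ _ t ↾)
        ps , eP , fwd≤ = LeStep-inp (C.R≤-step _ _ t ≤) eQ
    in ps , eP , follows fwd↾ fwd≤

  bystander-step : ∀ {s p q gs l s₁ r m} → gnode G s ≡ com p q gs → r ≢ p → r ≢ q →
                   (l , s₁) ∈ gs → Agrees r m s → Agrees r m s₁
  bystander-step e _ _ s₁∈ (inj₁ (¬part , halted)) = inj₁ (¬part ∘ PartAt-child e s₁∈ , halted)
  bystander-step e r≢p r≢q s₁∈ (inj₂ (t , ↾ , ≤))
    with ProjStep-bystander e r≢p r≢q (C.R↾-step _ _ t ↾)
  ... | inj₁ (¬part , eQ) = inj₁ (¬part ∘ PartAt-child e s₁∈ , LeStep-inact (C.R≤-step _ _ t ≤) eQ)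
  ... | inj₂ stay         = inj₂ (t , stay s₁∈ , ≤)

  agrees-active : ∀ {r m s} → Agrees r m s → pnode (P r) m ≢ inact → PartAt G s r
  agrees-active (inj₁ (_ , halted)) active = contradiction halted active
  agrees-active {r} {m} {s} (inj₂ (t , ↾ , ≤)) active with C.R↾-step r s t ↾
  ... | pj-0 _ eQ               = contradiction (LeStep-inact (C.R≤-step r m t ≤) eQ) active
  ... | pj-in _ part _ _ _      = part
  ... | pj-out _ part _ _ _ _   = part
  ... | pj-skip _ part _ _ _ _  = part

  path-run : ∀ {r m s τ s′} → Reach G s → Agrees r m s → Path G s τ s′ → ∃[ m′ ] Run (P r) r m τ m′
  path-run R agrees nil = _ , []
  path-run {r} R agrees (cons {p = p} {q} e s₁∈ path) with r ≟ p | r ≟ q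
  ... | yes refl | _ =
    let _ , eP , fol , _ = sender-step R e agrees
        m₁ , m₁∈ , agrees₁ = fol s₁∈
        m′ , run = path-run (reach-step R e s₁∈) agrees₁ path
    in m′ , send refl eP m₁∈ run
  ... | no _ | yes refl =
    let _ , eP , fol = receiver-step R e agrees
        m₁ , m₁∈ , agrees₁ = fol s₁∈
        m′ , run = path-run (reach-step R e s₁∈) agrees₁ path
    in m′ , recv refl eP m₁∈ run
  ... | no r≢p | no r≢q =
    let m′ , run = path-run (reach-step R e s₁∈) (bystander-step e r≢p r≢q s₁∈ agrees) path
    in m′ , skip (∉-pair r≢p r≢q) run

-- Replaying traces

EventAt : (G : GType) → Fin (gsize G) → Trace → Comm → Set
EventAt G s σ α = ∃[ σ′ ] ((∃[ t ] Path G s (σ′ ∷ʳ α) t) × ev σ′ α ∼ ev σ α)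

module _ {G : GType} where

  EventAt-interact : ∀ {s p q gs l s₁} ρ ρ′ α → gnode G s ≡ com p q gs → (l , s₁) ∈ gs →
    All (Disjoint (comm p q l)) ρ → EventAt G s₁ (ρ ++ ρ′) α → EventAt G s (ρ ++ comm p q l ∷ ρ′) α
  EventAt-interact {p = p} {q} {l = l} ρ ρ′ α e s₁∈ pq#ρ (σ′ , (t , path) , ev∼) =
    comm p q l ∷ σ′ , (t , cons e s₁∈ path) ,
    ∼-trans (∘ᶜ-resp-∼ (comm p q l) ev∼) (ev-resp-∼ α (∼-sym (∼-move-front (comm p q l) ρ ρ′ pq#ρ)))

  EventAt-bypass : ∀ {s p q gs l s₁} σ α → gnode G s ≡ com p q gs → (l , s₁) ∈ gs →
    All (Disjoint (comm p q l)) σ → Disjoint (comm p q l) α → EventAt G s₁ σ α → EventAt G s σ α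
  EventAt-bypass {p = p} {q} {l = l} σ α e s₁∈ pq#σ pq#α (σ′ , (t , path) , ev∼) =
    comm p q l ∷ σ′ , (t , cons e s₁∈ path) ,
    subst (_∼ ev σ α) (sym (∘ᶜ-apart (comm p q l) (ev σ′ α) pq-apart)) ev∼
    where
    pq-apart : meets (comm p q l) (ev σ′ α) ≡ false
    pq-apart = trans (meets-resp-∼ (comm p q l) ev∼)
                     (All-Disjoint⇒meets≡false (comm p q l) (All-ev σ α pq#σ pq#α))

module Replay (G : GType) (G-ok : IsGlobalType G) (G-bounded : Bounded G)
              (P : Participant → PType) (P-ok : ∀ r → IsProcess (P r))
              (conf : ∀ r → Conforms G r (P r)) where

  open Agreement G G-ok P conf

  Runnable : Participant → Fin (gsize G) → Trace → Set
  Runnable r s τ = ∃[ m ] (PReach (P r) m × Agrees r m s × ∃[ m′ ] Run (P r) r m τ m′)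

  out-unique : ∀ {r m q ps} → PReach (P r) m → pnode (P r) m ≡ out q ps → Unique (map proj₁ ps)
  out-unique {r} {m} reach eP = proj₂ (subst OKP eP (P-ok r m reach))

  inp-unique : ∀ {r m p ps} → PReach (P r) m → pnode (P r) m ≡ inp p ps → Unique (map proj₁ ps)
  inp-unique {r} {m} reach eP = proj₂ (subst OKP eP (P-ok r m reach))

  sender-fires : ∀ {s p q gs} ρ γ τ → Reach G s → gnode G s ≡ com p q gs →
    All ((p ∉_) ∘ partC) ρ → Runnable p s (ρ ++ γ ∷ τ) →
    p ∉ partC γ ⊎ (snd γ ≡ p × rcv γ ≡ q × (∃[ s₁ ] ((lab γ , s₁) ∈ gs)) ×
                   (∀ {s₁} → (lab γ , s₁) ∈ gs → Runnable p s₁ (ρ ++ τ)))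
  sender-fires {gs = gs} ρ γ τ R e p∉ρ (m , reach , agrees , m′ , run)
    with sender-step R e agrees
  ... | ps , eP , fol , bwd with run-out-∷ eP (run-++-idle⁻ ρ p∉ρ run)
  ...   | inj₁ p∉γ = inj₁ p∉γ
  ...   | inj₂ (refl , rcv≡q , m₁ , m₁∈ , run₁) = inj₂ (refl , rcv≡q , bwd m₁∈ , continue)
    where
    continue : ∀ {s₁} → (lab γ , s₁) ∈ gs → Runnable (snd γ) s₁ (ρ ++ τ)
    continue s₁∈ with fol s₁∈
    ... | m₂ , m₂∈ , agrees₂ with branch-functional (out-unique reach eP) m₁∈ m₂∈
    ... | refl = m₁ , there reach (inj₂ eP) m₁∈ , agrees₂ , m′ , run-++⁺ (run-idle p∉ρ) run₁

  receiver-fires : ∀ {s p q gs} ρ γ τ → Reach G s → gnode G s ≡ com p q gs →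
    All ((q ∉_) ∘ partC) ρ → Runnable q s (ρ ++ γ ∷ τ) →
    q ∉ partC γ ⊎ (rcv γ ≡ q × snd γ ≡ p × (∀ {s₁} → (lab γ , s₁) ∈ gs → Runnable q s₁ (ρ ++ τ)))
  receiver-fires {gs = gs} ρ γ τ R e q∉ρ (m , reach , agrees , m′ , run)
    with receiver-step R e agrees
  ... | ps , eP , fol with run-inp-∷ eP (run-++-idle⁻ ρ q∉ρ run)
  ...   | inj₁ q∉γ = inj₁ q∉γ
  ...   | inj₂ (refl , snd≡p , m₁ , m₁∈ , run₁) = inj₂ (refl , snd≡p , continue)
    where
    continue : ∀ {s₁} → (lab γ , s₁) ∈ gs → Runnable (rcv γ) s₁ (ρ ++ τ)
    continue s₁∈ with fol s₁∈
    ... | m₂ , m₂∈ , agrees₂ with branch-functional (inp-unique reach eP) m₁∈ m₂∈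
    ... | refl = m₁ , there reach (inj₁ eP) m₁∈ , agrees₂ , m′ , run-++⁺ (run-idle q∉ρ) run₁

  bystander-fires : ∀ {s p q gs l s₁ r} ρ τ → gnode G s ≡ com p q gs → r ≢ p → r ≢ q →
    (l , s₁) ∈ gs → Runnable r s (ρ ++ comm p q l ∷ τ) → Runnable r s₁ (ρ ++ τ)
  bystander-fires ρ τ e r≢p r≢q s₁∈ (m , reach , agrees , m′ , run) =
    m , reach , bystander-step e r≢p r≢q s₁∈ agrees , m′ , run-drop ρ (∉-pair r≢p r≢q) run

  -- The label 0 is a placeholder: Disjoint (comm p q l) depends only on p and q.
  fire : ∀ {s p q gs} ρ γ τ → Reach G s → gnode G s ≡ com p q gs →
    All (Disjoint (comm p q 0)) ρ → ¬ Disjoint (comm p q 0) γ → (∀ r → Runnable r s (ρ ++ γ ∷ τ)) →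
    snd γ ≡ p × rcv γ ≡ q × ∃[ s₁ ] ((lab γ , s₁) ∈ gs × (∀ r → Runnable r s₁ (ρ ++ τ)))
  fire {p = p} {q} ρ γ τ R e pq#ρ pq∩γ runs
    with sender-fires ρ γ τ R e (All-Disjoint⇒snd∉ (comm p q 0) pq#ρ) (runs p)
       | receiver-fires ρ γ τ R e (All-Disjoint⇒rcv∉ (comm p q 0) pq#ρ) (runs q)
  ... | inj₁ p∉γ | inj₁ q∉γ          = contradiction (∉∉⇒Disjoint 0 γ p∉γ q∉γ) pq∩γ
  ... | inj₁ p∉γ | inj₂ (_ , snd≡p , _) = contradiction (here (sym snd≡p)) p∉γ
  ... | inj₂ (_ , rcv≡q , _) | inj₁ q∉γ = contradiction (there (here (sym rcv≡q))) q∉γ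
  ... | inj₂ (refl , refl , (s₁ , s₁∈) , continue-p) | inj₂ (_ , _ , continue-q) =
    refl , refl , s₁ , s₁∈ , runs₁
    where
    runs₁ : ∀ r → Runnable r s₁ (ρ ++ τ)
    runs₁ r with r ≟ snd γ | r ≟ rcv γ
    ... | yes refl | _        = continue-p s₁∈
    ... | no _     | yes refl = continue-q s₁∈
    ... | no r≢p   | no r≢q   = bystander-fires ρ τ e r≢p r≢q s₁∈ (runs r)

  bypass : ∀ {s p q gs l s₁} τ → Reach G s → gnode G s ≡ com p q gs → (l , s₁) ∈ gs →
    All (Disjoint (comm p q 0)) τ → (∀ r → Runnable r s τ) → ∀ r → Runnable r s₁ τ
  bypass {p = p} {q} τ R e s₁∈ pq#τ runs r with runs r | r ≟ p | r ≟ q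
  ... | _ , reach , agrees , _ | yes refl | _ =
    let _ , eP , fol , _ = sender-step R e agrees
        m₁ , m₁∈ , agrees₁ = fol s₁∈
    in m₁ , there reach (inj₂ eP) m₁∈ , agrees₁ , m₁ , run-idle (All-Disjoint⇒snd∉ (comm p q 0) pq#τ)
  ... | _ , reach , agrees , _ | no _ | yes refl =
    let _ , eP , fol = receiver-step R e agrees
        m₁ , m₁∈ , agrees₁ = fol s₁∈
    in m₁ , there reach (inj₁ eP) m₁∈ , agrees₁ , m₁ , run-idle (All-Disjoint⇒rcv∉ (comm p q 0) pq#τ)
  ... | m , reach , agrees , run | no r≢p | no r≢q =
    m , reach , bystander-step e r≢p r≢q s₁∈ agrees , run

  runnable-participates : ∀ {s} σ α → Runnable (snd α) s (σ ∷ʳ α) → PartAt G s (snd α)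
  runnable-participates σ α (_ , _ , agrees , _ , run) =
    agrees-active agrees (run-active σ (here refl) run)

  replay-interacting : ∀ k {s p q gs} → Reach G s → gnode G s ≡ com p q gs → ∀ ρ γ ρ′ α →
    length (ρ ++ γ ∷ ρ′) ≤ k → All (Disjoint (comm p q 0)) ρ → ¬ Disjoint (comm p q 0) γ →
    (∀ r → Runnable r s ((ρ ++ γ ∷ ρ′) ∷ʳ α)) → EventAt G s (ρ ++ γ ∷ ρ′) α

  replay-bypassing : ∀ k n {s p q gs} → Reach G s → gnode G s ≡ com p q gs → ∀ σ α →
    length σ ≤ k → DepthBound G s (snd α) n →
    All (Disjoint (comm p q 0)) σ → Disjoint (comm p q 0) α →
    (∀ r → Runnable r s (σ ∷ʳ α)) → EventAt G s σ α

  replay-last : ∀ {s p q gs} → Reach G s → gnode G s ≡ com p q gs → ∀ σ α →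
    All (Disjoint (comm p q 0)) σ → ¬ Disjoint (comm p q 0) α →
    (∀ r → Runnable r s (σ ∷ʳ α)) → EventAt G s σ α
  replay-last R e σ α pq#σ pq∩α runs with fire σ α [] R e pq#σ pq∩α runs
  ... | refl , refl , s₁ , s₁∈ , _ =
    [] , (s₁ , cons e s₁∈ nil) , ∼-reflexive (sym (ev-apart α σ pq#σ))

  -- Termination: an interaction shortens σ (fuel k); a bypass keeps σ and lowers the
  -- depth bound n of snd α.
  replay : ∀ k n {s} → Reach G s → ∀ σ α → length σ ≤ k → DepthBound G s (snd α) n →
           (∀ r → Runnable r s (σ ∷ʳ α)) → EventAt G s σ α
  replay k n {s} R σ α len bound runs with gnode G s in e
  ... | end = contradiction (runnable-participates σ α (runs (snd α))) (PartAt-end e)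
  ... | com p q gs with first (toSum ∘ disjoint? (comm p q 0)) σ
  ...   | inj₁ found with toView found
  ...     | first-at pq#ρ pq∩γ ρ′ = replay-interacting k R e _ _ ρ′ α len pq#ρ pq∩γ runs
  replay k n R σ α len bound runs | com p q gs | inj₂ pq#σ with disjoint? (comm p q 0) α
  ... | yes pq#α = replay-bypassing k n R e σ α len bound pq#σ pq#α runs
  ... | no pq∩α  = replay-last R e σ α pq#σ pq∩α runs

  replay-interacting zero R e ρ γ ρ′ α len _ _ _ =
    contradiction (subst (_≤ 0) (length-++-sucʳ ρ γ ρ′) len) λ ()
  replay-interacting (suc k) {s} R e ρ γ ρ′ α len pq#ρ pq∩γ runs
    with fire ρ γ (ρ′ ∷ʳ α) R e pq#ρ pq∩γ
              (λ r → subst (Runnable r s) (++-assoc ρ (γ ∷ ρ′) (α ∷ [])) (runs r))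
  ... | refl , refl , s₁ , s₁∈ , runs₁ =
    let n₁ , bound₁ = G-bounded _ _ (proj₂ (reach-step R e s₁∈)) (snd α)
    in EventAt-interact ρ ρ′ α e s₁∈ pq#ρ
         (replay k n₁ (reach-step R e s₁∈) (ρ ++ ρ′) α len′ bound₁ runs₁′)
    where
    len′ : length (ρ ++ ρ′) ≤ k
    len′ = s≤s⁻¹ (subst (_≤ suc k) (length-++-sucʳ ρ γ ρ′) len)
    runs₁′ : ∀ r → Runnable r s₁ ((ρ ++ ρ′) ∷ʳ α)
    runs₁′ r = subst (Runnable r s₁) (sym (++-assoc ρ ρ′ (α ∷ []))) (runs₁ r)

  replay-bypassing k zero R e σ α _ bound _ _ runs =
    contradiction (runnable-participates σ α (runs (snd α))) (DepthBound-zero bound)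
  replay-bypassing k (suc n) R e σ α len bound pq#σ pq#α runs =
    let _ , gs≢[] , _ = ok-at G-ok R e
        (_ , s₁) , s₁∈ = some-member gs≢[]
    in EventAt-bypass σ α e s₁∈ pq#σ pq#α
         (replay k n (reach-step R e s₁∈) σ α len
            (DepthBound-child e s₁∈ (λ snd∈pq → pq#α (snd α) snd∈pq (here refl)) bound)
            (bypass (σ ∷ʳ α) R e s₁∈ (∷ʳ⁺ pq#σ pq#α) runs))

  replay-trace : ∀ σ α → (∀ r → Runnable r (groot G) (σ ∷ʳ α)) → EventAt G (groot G) σ α
  replay-trace σ α runs =
    let n , bound = G-bounded [] (groot G) nil (snd α)
    in replay (length σ) n ([] , nil) σ α ≤-refl bound runs

IsEv-transfer : ∀ {G G′} → IsGlobalType G → IsGlobalType G′ → Bounded G′ →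
  (P : Participant → PType) → (∀ r → IsProcess (P r)) →
  (∀ r → Conforms G r (P r)) → (∀ r → Conforms G′ r (P r)) →
  ∀ {τ} → IsEv G τ → IsEv G′ τ
IsEv-transfer {G} {G′} G-ok G′-ok G′-bounded P P-ok conf conf′ (σ , α , (_ , _ , path) , τ∼) =
  let σ′ , (t′ , path′) , ev∼ = replay-trace σ α runs
  in σ′ , α , (∷ʳ≢[] σ′ α , t′ , path′) ,
     ∼-trans τ∼ (∼-sym ev∼)
  where
  module A = Agreement G G-ok P conf
  module A′ = Agreement G′ G′-ok P conf′
  open Replay G′ G′-ok G′-bounded P P-ok conf′
  runs : ∀ r → Runnable r (groot G′) (σ ∷ʳ α)
  runs r = proot (P r) , here , A′.agrees-root r , A.path-run ([] , nil) (A.agrees-root r) path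

mainTheorem1 : (G G' : GType) → IsGlobalType G → IsGlobalType G' →
    WellFormed G → WellFormed G' →
    (N : Network) → IsNetwork N → N ⊢ G → N ⊢ G' →
    Iso (S G) (S G')
mainTheorem1 G G′ G-ok G′-ok (_ , G-bounded) (_ , G′-bounded) N N-ok ⊢G ⊢G′ = record
  { to = map₂ G⇒G′ ; from = map₂ G′⇒G
  ; to-cong = id ; from-cong = id ; from-to = λ _ → ∼-refl ; to-from = λ _ → ∼-refl
  ; ≤-pres = id ; ≤-refl = id ; #-pres = id ; #-refl = id }
  where
  procs : ∀ r → Σ PType λ P → IsProcess P × Conforms G r P × Conforms G′ r P
  procs = network-processes N-ok ⊢G ⊢G′
  P : Participant → PType
  P r = proj₁ (procs r)
  P-ok : ∀ r → IsProcess (P r)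
  P-ok r = proj₁ (proj₂ (procs r))
  conf : ∀ r → Conforms G r (P r)
  conf r = proj₁ (proj₂ (proj₂ (procs r)))
  conf′ : ∀ r → Conforms G′ r (P r)
  conf′ r = proj₂ (proj₂ (proj₂ (procs r)))
  G⇒G′ : ∀ {τ} → IsEv G τ → IsEv G′ τ
  G⇒G′ = IsEv-transfer G-ok G′-ok G′-bounded P P-ok conf conf′
  G′⇒G : ∀ {τ} → IsEv G′ τ → IsEv G τ
  G′⇒G = IsEv-transfer G′-ok G-ok G-bounded P P-ok conf′ conf
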